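{- Let $\psi:\mathbb{N}^*\to\mathbb{N}^*\sqcup\mathcal{A}$ be a function such that for each $n\ge1$, either $\psi(n)\in\mathcal{A}$ or $1\le\psi(n)\le n-1$. Then $\psi$ is reduced if and only if the palindromic prefixes of $w_\psi$ are exactly the words $\pi_i$, $i\ge1$, constructed from $\psi$.
   Context: The alphabet $\mathcal{A}$ is arbitrary and disjoint from $\mathbb{N}^*=\{1,2,\dots\}$; the empty word $\varepsilon$ is a palindrome. For finite words with $u'$ a prefix of $u$, $u'^{ -1}u$ denotes the word $u''$ with $u=u'u''$. Given $\psi$ as in the claim, define $\pi_1=\varepsilon$ and for $i\ge1$: $\pi_{i+1}=\pi_i\,\pi_{\psi(i)}^{ -1}\pi_i$ if $\psi(i)\in\mathbb{N}^*$, $\pi_{i+1}=\pi_i\,\psi(i)\,\pi_i$ if $\psi(i)\in\mathcal{A}$; each $\pi_i$ is a palindrome and a proper prefix of $\pi_{i+1}$, and $w_\psi$ is the limit infinite word. Let $(t_k)_{k\ge0}$ be the (finite or infinite) increasing enumeration of all $n\ge1$ such that either $1\le\psi(n)\le n-2$ or $\psi(n)\in\mathcal{A}$ (so $t_0=1$). $\psi$ is reduced if for every $k\ge1$ such that $t_k$ exists: $\psi(t_k)\ne\psi(t_{k-1})$, and either $\psi(t_k)\in\mathcal{A}$ or $\psi(t_k)<t_{k-1}$. -}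

module Defs where

open import Level using (Level)
open import Data.Nat using (ℕ; zero; suc; _≤_; _<_; _∸_; _+_; _≤?_)
open import Data.Sum using (_⊎_; inj₁; inj₂)
open import Data.Product using (∃; _×_; _,_)
open import Data.List using (List; []; _∷_; _++_; drop; length; reverse; head)
open import Data.Maybe using (Maybe; just)
open import Relation.Nullary using (¬_; yes; no)
open import Relation.Binary.PropositionalEquality using (_≡_)

private variable ℓ : Level

-- Positions n ≥ 1 of ℕ* are represented by n : ℕ; index 0 is never used.
-- The codomain ℕ* ⊔ 𝒜 is represented by ℕ ⊎ A (inj₁ m = the integer m,
-- inj₂ a = the letter a); the value inj₁ 0 is excluded by the hypotheses.

-- u'^{-1} u : removes the prefix u' from u (only used when u' is a prefix of u).
_⁻¹·_ : {A : Set ℓ} → List A → List A → List A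
u' ⁻¹· u = drop (length u') u

stepπ : {A : Set ℓ} → (ℕ → List A) → List A → ℕ ⊎ A → List A
stepπ look πi (inj₁ m) = πi ++ (look m ⁻¹· πi)
stepπ look πi (inj₂ a) = πi ++ (a ∷ πi)

-- tab ψ n j = π_j for 1 ≤ j ≤ n.
tab : {A : Set ℓ} → (ℕ → ℕ ⊎ A) → ℕ → ℕ → List A
tab ψ zero j = []
tab ψ (suc n) j with j ≤? n
... | yes _ = tab ψ n j
... | no _ with n
...   | zero = []                                  -- π_1 = ε
...   | suc i = stepπ (tab ψ n) (tab ψ n n) (ψ n)

-- π ψ i = π_i  (i ≥ 1; π ψ 0 is junk)
π : {A : Set ℓ} → (ℕ → ℕ ⊎ A) → ℕ → List A
π ψ i = tab ψ i i

-- The infinite word w_ψ: its n-th letter (0-based) is the n-th letter of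
-- π_{n+2}, which has length ≥ n+1 (so this is always 'just').
w : {A : Set ℓ} → (ℕ → ℕ ⊎ A) → ℕ → Maybe A
w ψ n = head (drop n (π ψ (suc (suc n))))

IsPrefixOfW : {A : Set ℓ} → (ℕ → ℕ ⊎ A) → List A → Set ℓ
IsPrefixOfW ψ u = ∀ k → k < length u → w ψ k ≡ head (drop k u)

IsPalindrome : {A : Set ℓ} → List A → Set ℓ
IsPalindrome u = reverse u ≡ u

InT : {A : Set ℓ} → (ℕ → ℕ ⊎ A) → ℕ → Set ℓ
InT {A = A} ψ n = 1 ≤ n × ((∃ λ m → ψ n ≡ inj₁ m × 1 ≤ m × m ≤ n ∸ 2)
                          ⊎ (∃ λ (a : A) → ψ n ≡ inj₂ a))

-- t_{k-1} = s and t_k = t are consecutive terms of the enumeration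
Consecutive : {A : Set ℓ} → (ℕ → ℕ ⊎ A) → ℕ → ℕ → Set ℓ
Consecutive ψ s t = InT ψ s × InT ψ t × s < t × (∀ r → s < r → r < t → ¬ InT ψ r)

Reduced : {A : Set ℓ} → (ℕ → ℕ ⊎ A) → Set ℓ
Reduced {A = A} ψ = ∀ s t → Consecutive ψ s t →
  (¬ (ψ t ≡ ψ s)) ×
  ((∃ λ (a : A) → ψ t ≡ inj₂ a) ⊎ (∃ λ m → ψ t ≡ inj₁ m × m < s))

{-# OPTIONS --safe #-}
-- Let p_i = |π_{i+1}| − |π_i| (gap i).  Since π_i is a palindromic prefix of the palindrome
-- π_{i+1}, p_i is a period of π_{i+1}; in the same way, a palindromic prefix of w_ψ whose length
-- L lies strictly between |π_i| and |π_{i+1}| amounts to the period |π_{i+1}| − L < p_i of π_{i+1}.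
-- Hence the π_i are all the palindromic prefixes iff every p_i is the least period of π_{i+1}.
--
-- Where ψ(n) = n − 1, i.e. off T = {t_k}, p_n = p_{n−1}; so minimality is only at stake at some
-- t = t_k.  Let s = t_{k−1} and r = p_s = p_{t−1}, so that |π_t| = |π_s| + (t − s) r.  By the weak
-- Fine–Wilf theorem a shorter period of π_{t+1} may be assumed to divide p_t and to be a multiple
-- of r.  When ψ(t) is a letter or ψ(t) < s, comparing lengths shows that this forces ψ(t) = ψ(s),
-- or ψ(s) = m ≤ s − 2 with 2 p_s ≤ |π_s| + 1; the latter is impossible because p_{s−1} would then
-- be a proper divisor of p_s and a period of π_{s+1}.  Conversely, if ψ(t) = ψ(s) or
-- s ≤ ψ(t) ≤ t − 2, then p_t is a proper multiple of r and r is a period of π_{t+1}.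

module Submission where

open import Defs
open import Level using (Level)
open import Data.Nat using (ℕ; zero; suc; _+_; _*_; _∸_; _≤_; _<_; z≤n; s≤s; z<s; _≤?_; _<?_; >-nonZero)
open import Data.Nat.Properties
open import Data.Nat.Divisibility
  using (_∣_; divides; ∣-refl; ∣-trans; ∣⇒≤; n∣m*n; ∣m∣n⇒∣m+n; ∣m+n∣m⇒∣n)
open import Data.Nat.Tactic.RingSolver using (solve-∀)
open import Data.Nat.Induction using (<-wellFounded; <-rec)
open import Induction.WellFounded using (Acc; acc)
open import Data.Sum using (_⊎_; inj₁; inj₂)
open import Data.Sum.Properties using (inj₁-injective)
open import Data.Product using (∃; _×_; _,_; proj₁; proj₂)
open import Data.List using (List; []; _∷_; _++_; drop; take; length; reverse; head; [_])
open import Data.List.Properties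
  using ( unfold-reverse; reverse-++; length-reverse; ++-assoc; ++-identityʳ
        ; length-++; length-drop; length-take; drop-drop )
open import Data.Maybe using (Maybe; just)
open import Data.Maybe.Properties using (just-injective)
open import Data.Empty using (⊥; ⊥-elim)
open import Relation.Nullary using (¬_; Dec; yes; no)
open import Relation.Binary.PropositionalEquality hiding ([_])
open import Relation.Binary.Definitions using (tri<; tri≈; tri>)
open import Function.Bundles using (_⇔_; mk⇔; Equivalence)

module Words {a} {A : Set a} where

  open ≡-Reasoning

  at : List A → ℕ → Maybe A
  at u k = head (drop k u)

  at-++ˡ : ∀ (u v : List A) {k} → k < length u → at (u ++ v) k ≡ at u k
  at-++ˡ (x ∷ u) v {zero}  _       = refl
  at-++ˡ (x ∷ u) v {suc k} (s≤s p) = at-++ˡ u v p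

  at-++ʳ : ∀ (u v : List A) k → at (u ++ v) (length u + k) ≡ at v k
  at-++ʳ []      v k = refl
  at-++ʳ (x ∷ u) v k = at-++ʳ u v k

  at-drop : ∀ n (u : List A) k → at (drop n u) k ≡ at u (n + k)
  at-drop n u k = cong head (drop-drop n k u)

  at-take : ∀ n (u : List A) {k} → k < n → at (take n u) k ≡ at u k
  at-take (suc n) []      _               = refl
  at-take (suc n) (x ∷ u) {zero}  _       = refl
  at-take (suc n) (x ∷ u) {suc k} (s≤s p) = at-take n u p

  drop-length-++ : ∀ (u v : List A) → drop (length u) (u ++ v) ≡ v
  drop-length-++ []      v = refl
  drop-length-++ (x ∷ u) v = drop-length-++ u v

  at-reverse : ∀ (u : List A) x y → suc (x + y) ≡ length u → at (reverse u) x ≡ at u y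
  at-reverse (b ∷ u) x zero e = begin
    at (reverse (b ∷ u)) x              ≡⟨ cong (λ v → at v x) (unfold-reverse b u) ⟩
    at (reverse u ++ [ b ]) x           ≡⟨ cong (at (reverse u ++ [ b ])) x≡ ⟩
    at (reverse u ++ [ b ]) (length (reverse u) + 0) ≡⟨ at-++ʳ (reverse u) [ b ] 0 ⟩
    just b                              ∎
    where
    x≡ : x ≡ length (reverse u) + 0
    x≡ = trans (trans (sym (+-identityʳ x)) (suc-injective e)) (sym (trans (+-identityʳ _) (length-reverse u)))
  at-reverse (b ∷ u) x (suc y) e = begin
    at (reverse (b ∷ u)) x    ≡⟨ cong (λ v → at v x) (unfold-reverse b u) ⟩
    at (reverse u ++ [ b ]) x ≡⟨ at-++ˡ (reverse u) [ b ] x< ⟩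
    at (reverse u) x          ≡⟨ at-reverse u x y e′ ⟩
    at u y                    ∎
    where
    e′ : suc (x + y) ≡ length u
    e′ = trans (sym (+-suc x y)) (suc-injective e)
    x< : x < length (reverse u)
    x< = subst (x <_) (trans e′ (sym (length-reverse u))) (s≤s (m≤m+n x y))

  ≡-by-at : ∀ (u v : List A) → length u ≡ length v → (∀ k → k < length u → at u k ≡ at v k) → u ≡ v
  ≡-by-at []      []      _ _ = refl
  ≡-by-at (x ∷ u) (y ∷ v) e f with f 0 (s≤s z≤n)
  ... | refl = cong (x ∷_) (≡-by-at u v (suc-injective e) (λ k k< → f (suc k) (s≤s k<)))

  palindrome-++-∷ : ∀ {u : List A} c → IsPalindrome u → IsPalindrome (u ++ c ∷ u)
  palindrome-++-∷ {u} c pal = begin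
    reverse (u ++ c ∷ u)           ≡⟨ reverse-++ u (c ∷ u) ⟩
    reverse (c ∷ u) ++ reverse u   ≡⟨ cong₂ _++_ (unfold-reverse c u) pal ⟩
    (reverse u ++ [ c ]) ++ u      ≡⟨ cong (λ v → (v ++ [ c ]) ++ u) pal ⟩
    (u ++ [ c ]) ++ u              ≡⟨ ++-assoc u [ c ] u ⟩
    u ++ c ∷ u                     ∎

  palindrome-++-⁻¹· : ∀ {P M : List A} → IsPalindrome P → IsPalindrome M → (∃ λ x → P ≡ M ++ x) →
                      IsPalindrome (P ++ (M ⁻¹· P))
  palindrome-++-⁻¹· {P} {M} palP palM (x , refl) = begin
    reverse ((M ++ x) ++ drop (length M) (M ++ x)) ≡⟨ cong (λ v → reverse ((M ++ x) ++ v)) (drop-length-++ M x) ⟩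
    reverse ((M ++ x) ++ x)                       ≡⟨ reverse-++ (M ++ x) x ⟩
    reverse x ++ reverse (M ++ x)                 ≡⟨ cong (reverse x ++_) palP ⟩
    reverse x ++ (M ++ x)                         ≡⟨ sym (++-assoc (reverse x) M x) ⟩
    (reverse x ++ M) ++ x                         ≡⟨ cong (λ v → (reverse x ++ v) ++ x) (sym palM) ⟩
    (reverse x ++ reverse M) ++ x                 ≡⟨ cong (_++ x) (sym (reverse-++ M x)) ⟩
    reverse (M ++ x) ++ x                         ≡⟨ cong (_++ x) palP ⟩
    (M ++ x) ++ x                                 ≡⟨ cong ((M ++ x) ++_) (sym (drop-length-++ M x)) ⟩
    (M ++ x) ++ drop (length M) (M ++ x)          ∎

inj₁≢inj₂ : ∀ {a b} {A : Set a} {B : Set b} {x : A} {y : B} → inj₁ x ≢ inj₂ y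
inj₁≢inj₂ ()

∣-positive⇒multiple : ∀ {d n} → d ∣ n → 0 < n → ∃ λ c → n ≡ suc c * d
∣-positive⇒multiple (divides zero    refl) ()
∣-positive⇒multiple (divides (suc c) eq)   _ = c , eq

m∣n∧m<n⇒m+m≤n : ∀ {m n} → m ∣ n → m < n → m + m ≤ n
m∣n∧m<n⇒m+m≤n {m} m∣n m<n with ∣-positive⇒multiple m∣n (≤-<-trans z≤n m<n)
... | zero  , refl = ⊥-elim (<-irrefl (sym (+-identityʳ m)) m<n)
... | suc c , refl = +-monoʳ-≤ m (m≤m+n m (c * m))

module Prefixes {a} {A : Set a} (W : ℕ → Maybe A) where

  open Words
  open ≡-Reasoning

  PrefixOf : List A → Set a
  PrefixOf u = ∀ k → k < length u → W k ≡ at u k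

  Palindrome : ℕ → Set a
  Palindrome L = ∀ x y → suc (x + y) ≡ L → W x ≡ W y

  Period : ℕ → ℕ → Set a
  Period L q = ∀ x → x + q < L → W x ≡ W (x + q)

  NoShorterPeriod : ℕ → ℕ → Set a
  NoShorterPeriod L r = ∀ q → 0 < q → q < r → ¬ Period L q

  prefix-palindrome : ∀ {u} → PrefixOf u → IsPalindrome u → Palindrome (length u)
  prefix-palindrome {u} pre pal x y e = begin
    W x              ≡⟨ pre x (subst (x <_) e (s≤s (m≤m+n x y))) ⟩
    at u x           ≡⟨ cong (λ v → at v x) (sym pal) ⟩
    at (reverse u) x ≡⟨ at-reverse u x y e ⟩
    at u y           ≡⟨ sym (pre y (subst (y <_) e (s≤s (m≤n+m y x)))) ⟩
    W y              ∎

  palindrome-prefix : ∀ {u} → PrefixOf u → Palindrome (length u) → IsPalindrome u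
  palindrome-prefix {u} pre pal = ≡-by-at (reverse u) u (length-reverse u) mirror
    where
    mirror : ∀ k → k < length (reverse u) → at (reverse u) k ≡ at u k
    mirror k k< with m≤n⇒∃[o]m+o≡n (subst (k <_) (length-reverse u) k<)
    ... | y , e = begin
      at (reverse u) k ≡⟨ at-reverse u k y e ⟩
      at u y           ≡⟨ sym (pre y (subst (y <_) e (s≤s (m≤n+m y k)))) ⟩
      W y              ≡⟨ sym (pal k y e) ⟩
      W k              ≡⟨ pre k (subst (k <_) e (s≤s (m≤m+n k y))) ⟩
      at u k           ∎

  period-≤ : ∀ {L L′ q} → L′ ≤ L → Period L q → Period L′ q
  period-≤ L′≤L per x x< = per x (≤-trans x< L′≤L)

  palindromes⇒period : ∀ L d → Palindrome (L + d) → Palindrome L → Period (L + d) d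
  palindromes⇒period L d palLd palL x x< with m≤n⇒∃[o]m+o≡n (+-cancelʳ-< d x L x<)
  ... | y , e = trans (palL x y e) (sym (palLd (x + d) y (trans (cong suc (rearrange x d y)) (cong (_+ d) e))))
    where
    rearrange : ∀ x d y → x + d + y ≡ x + y + d
    rearrange = solve-∀

  period⇒palindrome : ∀ q L → Palindrome (q + L) → Period (q + L) q → Palindrome L
  period⇒palindrome q L palqL per x y e = trans (per x x<) (palqL (x + q) y e′)
    where
    x< : x + q < q + L
    x< = subst (_< q + L) (+-comm q x) (+-monoʳ-< q (subst (x <_) e (s≤s (m≤m+n x y))))
    rearrange : ∀ x q y → suc (x + q + y) ≡ q + suc (x + y)
    rearrange = solve-∀
    e′ : suc (x + q + y) ≡ q + L
    e′ = trans (rearrange x q y) (cong (q +_) e)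

  period-difference : ∀ L p d → Period L p → Period L (p + d) → p + (p + d) ≤ L → Period L d
  period-difference L p d perp perpd le x x< with x + (p + d) <? L
  ... | yes lt = begin
    W x             ≡⟨ perpd x lt ⟩
    W (x + (p + d)) ≡⟨ cong W (sym (swap x d p)) ⟩
    W (x + d + p)   ≡⟨ sym (perp (x + d) (subst (_< L) (sym (swap x d p)) lt)) ⟩
    W (x + d)       ∎
    where
    swap : ∀ x d p → x + d + p ≡ x + (p + d)
    swap = solve-∀
  ... | no ¬lt with m≤n⇒∃[o]m+o≡n (+-cancelʳ-≤ (p + d) p x (≤-trans le (≮⇒≥ ¬lt)))
  ...   | y , refl = begin
    W (p + y)       ≡⟨ cong W (+-comm p y) ⟩
    W (y + p)       ≡⟨ sym (perp y (≤-<-trans (+-monoʳ-≤ y (m≤m+n p d)) y+p+d<)) ⟩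
    W y             ≡⟨ perpd y y+p+d< ⟩
    W (y + (p + d)) ≡⟨ cong W (swap y p d) ⟩
    W (p + y + d)   ∎
    where
    swap : ∀ y p d → y + (p + d) ≡ p + y + d
    swap = solve-∀
    y+p+d< : y + (p + d) < L
    y+p+d< = subst (_< L) (sym (swap y p d)) x<

  fine-wilf : ∀ {L} p q → 0 < p → Period L p → Period L q → p + q ≤ L →
              ∃ λ d → 0 < d × d ∣ p × d ∣ q × Period L d
  fine-wilf {L} p q = euclid p q (<-wellFounded (p + q))
    where
    euclid : ∀ p q → Acc _<_ (p + q) → 0 < p → Period L p → Period L q → p + q ≤ L →
             ∃ λ d → 0 < d × d ∣ p × d ∣ q × Period L d
    euclid (suc p) zero _ p>0 perp _ _ = suc p , p>0 , ∣-refl , divides 0 refl , perp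
    euclid (suc p) (suc q) (acc rec) p>0 perp perq le with suc p ≤? suc q
    ... | yes p≤q with m≤n⇒∃[o]m+o≡n p≤q
    ...   | e , refl with euclid (suc p) e (rec (+-monoʳ-< (suc p) (s≤s (m≤n+m e p)))) p>0 perp
                            (period-difference L (suc p) e perp perq le)
                            (≤-trans (+-monoʳ-≤ (suc p) (m≤n+m e (suc p))) le)
    ...     | d , d>0 , d∣p , d∣e , perd = d , d>0 , d∣p , ∣m∣n⇒∣m+n d∣p d∣e , perd
    euclid (suc p) (suc q) (acc rec) p>0 perp perq le | no p≰q with m≤n⇒∃[o]m+o≡n (<⇒≤ (≰⇒> p≰q))
    ... | e , eq with euclid (suc q) e (rec (subst (_< suc p + suc q) (sym eq) (m<m+n (suc p) z<s))) z<s perq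
                       (period-difference L (suc q) e perq (subst (Period L) (sym eq) perp) le′)
                       (subst (_≤ L) (sym eq) (≤-trans (m≤m+n (suc p) (suc q)) le))
      where
      le′ : suc q + (suc q + e) ≤ L
      le′ = subst (_≤ L) (trans (+-comm (suc p) (suc q)) (cong (suc q +_) (sym eq))) le
    ...   | d , d>0 , d∣q , d∣e , perd = d , d>0 , subst (d ∣_) eq (∣m∣n⇒∣m+n d∣q d∣e) , d∣q , perd

  period-multiple : ∀ {L q} → Period L q → ∀ c x → x + c * q < L → W x ≡ W (x + c * q)
  period-multiple {L} {q} per zero    x _  = cong W (sym (+-identityʳ x))
  period-multiple {L} {q} per (suc c) x x< = begin
    W x               ≡⟨ period-multiple per c x (≤-<-trans (+-monoʳ-≤ x (m≤n+m (c * q) q)) x<) ⟩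
    W (x + c * q)     ≡⟨ per (x + c * q) (subst (_< L) (sym (shift x c q)) x<) ⟩
    W (x + c * q + q) ≡⟨ cong W (shift x c q) ⟩
    W (x + suc c * q) ∎
    where
    shift : ∀ x c q → x + c * q + q ≡ x + suc c * q
    shift = solve-∀

  period-extend : ∀ {L L′} q c → Period L (suc c * q) → Period L′ q → suc c * q ≤ L′ → L′ ≤ L →
                  Period L q
  period-extend zero c _ _ _ _ x _ = cong W (sym (+-identityʳ x))
  period-extend {L} {L′} q@(suc _) c perP perq P≤L′ L′≤L = <-rec _ shift
    where
    P = suc c * q
    shift : ∀ x → (∀ {y} → y < x → y + q < L → W y ≡ W (y + q)) → x + q < L → W x ≡ W (x + q)
    shift x rec x< with x + q <? L′
    ... | yes lt = perq x lt
    ... | no ¬lt with P ≤? x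
    ...   | yes P≤x with m≤n⇒∃[o]m+o≡n P≤x
    ...     | y , refl = begin
      W (P + y)     ≡⟨ cong W (+-comm P y) ⟩
      W (y + P)     ≡⟨ sym (perP y (≤-<-trans (+-monoʳ-≤ y (m≤m+n P q)) (subst (_< L) (swap y P q) x<))) ⟩
      W y           ≡⟨ rec (m<n+m y z<s) (≤-<-trans (m≤m+n (y + q) P) (subst (_< L) (swap′ y P q) x<)) ⟩
      W (y + q)     ≡⟨ perP (y + q) (subst (_< L) (swap′ y P q) x<) ⟩
      W (y + q + P) ≡⟨ cong W (sym (swap′ y P q)) ⟩
      W (P + y + q) ∎
      where
      swap : ∀ y P q → P + y + q ≡ y + (P + q)
      swap = solve-∀
      swap′ : ∀ y P q → P + y + q ≡ y + q + P
      swap′ = solve-∀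
    shift x rec x< | no ¬lt | no P≰x
      with m≤n⇒∃[o]m+o≡n (+-cancelˡ-≤ q (c * q) x (subst (P ≤_) (+-comm x q) (≤-trans P≤L′ (≮⇒≥ ¬lt))))
    ...     | z , refl = begin
      W (c * q + z)     ≡⟨ cong W (+-comm (c * q) z) ⟩
      W (z + c * q)     ≡⟨ sym (period-multiple perq c z z+cq<L′) ⟩
      W z               ≡⟨ perP z (subst (_< L) (sym (swap z c q)) x<) ⟩
      W (z + P)         ≡⟨ cong W (swap z c q) ⟩
      W (c * q + z + q) ∎
      where
      z+cq<L′ : z + c * q < L′
      z+cq<L′ = subst (_< L′) (+-comm (c * q) z) (<-≤-trans (≰⇒> P≰x) P≤L′)
      swap : ∀ z c q → z + (q + c * q) ≡ c * q + z + q
      swap = solve-∀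

  no-shorter⇒∣ : ∀ {L r q} → 0 < r → Period L r → NoShorterPeriod L r →
                 Period L q → r + q ≤ L → r ∣ q
  no-shorter⇒∣ {r = r} r>0 perr none perq le with fine-wilf r _ r>0 perr perq le
  ... | d , d>0 , d∣r , d∣q , perd with m≤n⇒m<n∨m≡n (∣⇒≤ {{>-nonZero r>0}} d∣r)
  ...   | inj₁ d<r  = ⊥-elim (none d d>0 d<r perd)
  ...   | inj₂ refl = d∣q

  no-shorter-of-divisors : ∀ {L r} → Period L r → r + r ≤ suc L →
                           (∀ q → 0 < q → q < r → q ∣ r → ¬ Period L q) → NoShorterPeriod L r
  no-shorter-of-divisors {r = r} perr le none q q>0 q<r perq
    with fine-wilf q r q>0 perq perr (≤-pred (≤-trans (+-monoˡ-< r q<r) le))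
  ... | d , d>0 , d∣q , d∣r , perd = none d d>0 (≤-<-trans (∣⇒≤ {{>-nonZero q>0}} d∣q) q<r) d∣r perd

Admissible : ∀ {a} {A : Set a} → (ℕ → ℕ ⊎ A) → Set a
Admissible {A = A} ψ = ∀ n → 1 ≤ n → (∃ λ (c : A) → ψ n ≡ inj₂ c)
                                    ⊎ (∃ λ m → ψ n ≡ inj₁ m × 1 ≤ m × m ≤ n ∸ 1)

module Construction {a} {A : Set a} (ψ : ℕ → ℕ ⊎ A) (admissible : Admissible ψ) where

  open Words
  open Prefixes (w ψ) public
  open ≡-Reasoning

  data Move (n : ℕ) : Set a where
    letter : ∀ c → ψ n ≡ inj₂ c → Move n
    jump   : ∀ m → ψ n ≡ inj₁ m → 1 ≤ m → m < n → Move n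

  move : ∀ n → 1 ≤ n → Move n
  move (suc i) 1≤n with admissible (suc i) 1≤n
  ... | inj₁ (c , e)              = letter c e
  ... | inj₂ (m , e , 1≤m , m≤i) = jump m e 1≤m (s≤s m≤i)

  tab-stable : ∀ {j} n → j ≤ n → tab ψ n j ≡ π ψ j
  tab-stable zero    z≤n = refl
  tab-stable {j} (suc n) j≤n+1 with m≤n⇒m<n∨m≡n j≤n+1
  ... | inj₂ refl = refl
  ... | inj₁ (s≤s j≤n) with j ≤? n
  ...   | yes _   = tab-stable n j≤n
  ...   | no j≰n = ⊥-elim (j≰n j≤n)

  π-suc : ∀ i → π ψ (suc (suc i)) ≡ stepπ (tab ψ (suc i)) (π ψ (suc i)) (ψ (suc i))
  π-suc i with suc (suc i) ≤? suc i
  ... | yes i+2≤i+1 = ⊥-elim (1+n≰n i+2≤i+1)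
  ... | no _        = refl

  π-letter : ∀ i {c} → ψ (suc i) ≡ inj₂ c → π ψ (suc (suc i)) ≡ π ψ (suc i) ++ c ∷ π ψ (suc i)
  π-letter i e rewrite π-suc i | e = refl

  π-jump : ∀ i {m} → ψ (suc i) ≡ inj₁ m → m < suc i →
           π ψ (suc (suc i)) ≡ π ψ (suc i) ++ (π ψ m ⁻¹· π ψ (suc i))
  π-jump i {m} e m<n rewrite π-suc i | e | tab-stable (suc i) (<⇒≤ m<n) = refl

  π-suc-prefix : ∀ i → ∃ λ x → π ψ (suc i) ≡ π ψ i ++ x
  π-suc-prefix zero    = [] , refl
  π-suc-prefix (suc i) = extends (ψ (suc i)) (π-suc i)
    where
    extends : ∀ v → π ψ (suc (suc i)) ≡ stepπ (tab ψ (suc i)) (π ψ (suc i)) v →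
              ∃ λ x → π ψ (suc (suc i)) ≡ π ψ (suc i) ++ x
    extends (inj₁ _) e = _ , e
    extends (inj₂ _) e = _ , e

  π-prefix : ∀ {j i} → j ≤ i → ∃ λ x → π ψ i ≡ π ψ j ++ x
  π-prefix {j} {i} j≤i with m≤n⇒m<n∨m≡n j≤i
  ... | inj₂ refl = [] , sym (++-identityʳ (π ψ j))
  π-prefix {j} {suc i} _ | inj₁ (s≤s j≤i) with π-prefix j≤i | π-suc-prefix i
  ... | x , ex | y , ey = x ++ y , trans ey (trans (cong (_++ y) ex) (++-assoc (π ψ j) x y))

  π-palindrome : ∀ i → IsPalindrome (π ψ i)
  π-palindrome = <-rec _ palindromic
    where
    palindromic : ∀ i → (∀ {j} → j < i → IsPalindrome (π ψ j)) → IsPalindrome (π ψ i)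
    palindromic zero          _   = refl
    palindromic (suc zero)    _   = refl
    palindromic (suc (suc i)) rec with move (suc i) z<s
    ... | letter c e rewrite π-letter i e = palindrome-++-∷ c (rec ≤-refl)
    ... | jump m e _ m<n rewrite π-jump i e m<n =
      palindrome-++-⁻¹· (rec ≤-refl) (rec (m≤n⇒m≤1+n m<n)) (π-prefix (<⇒≤ m<n))

  len : ℕ → ℕ
  len i = length (π ψ i)

  len-≤ : ∀ {j i} → j ≤ i → len j ≤ len i
  len-≤ {j} j≤i with π-prefix j≤i
  ... | x , e = subst (len j ≤_) (sym (trans (cong length e) (length-++ (π ψ j)))) (m≤m+n (len j) (length x))

  gap : ℕ → ℕ
  gap i = len (suc i) ∸ len i

  len-suc : ∀ i → len (suc i) ≡ len i + gap i
  len-suc i = sym (m+[n∸m]≡n (len-≤ (n≤1+n i)))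

  gap-letter : ∀ {n c} → 1 ≤ n → ψ n ≡ inj₂ c → gap n ≡ suc (len n)
  gap-letter {suc i} {c} _ e = begin
    len (suc n) ∸ len n               ≡⟨ cong (λ v → length v ∸ len n) (π-letter i e) ⟩
    length (P ++ c ∷ P) ∸ len n       ≡⟨ cong (_∸ len n) (length-++ P) ⟩
    len n + suc (len n) ∸ len n       ≡⟨ m+n∸m≡n (len n) _ ⟩
    suc (len n)                       ∎
    where
    n = suc i
    P = π ψ n

  len-jump : ∀ {n m} → ψ n ≡ inj₁ m → m < n → len m + gap n ≡ len n
  len-jump {suc i} {m} e m<n = begin
    len m + (len (suc n) ∸ len n)                       ≡⟨ cong (λ v → len m + (length v ∸ len n)) (π-jump i e m<n) ⟩
    len m + (length (P ++ drop (len m) P) ∸ len n)      ≡⟨ cong (λ v → len m + (v ∸ len n)) (length-++ P) ⟩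
    len m + (len n + length (drop (len m) P) ∸ len n)   ≡⟨ cong (len m +_) (m+n∸m≡n (len n) _) ⟩
    len m + length (drop (len m) P)                     ≡⟨ cong (len m +_) (length-drop (len m) P) ⟩
    len m + (len n ∸ len m)                             ≡⟨ m+[n∸m]≡n (len-≤ (<⇒≤ m<n)) ⟩
    len n                                               ∎
    where
    n = suc i
    P = π ψ n

  gap-positive : ∀ n → 1 ≤ n → 0 < gap n
  gap-positive = <-rec _ positive
    where
    positive : ∀ n → (∀ {m} → m < n → 1 ≤ m → 0 < gap m) → 1 ≤ n → 0 < gap n
    positive n rec 1≤n with move n 1≤n
    ... | letter c e       = subst (0 <_) (sym (gap-letter 1≤n e)) z<s
    ... | jump m e 1≤m m<n = +-cancelˡ-< (len m) 0 (gap n) (subst (len m + 0 <_) (sym (len-jump e m<n)) lenm<lenn)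
      where
      lenm<lenn : len m + 0 < len n
      lenm<lenn = subst (_< len n) (sym (+-identityʳ (len m)))
        (<-≤-trans (subst (len m <_) (sym (len-suc m)) (m<m+n (len m) (rec m<n 1≤m))) (len-≤ m<n))

  len-step : ∀ n → 1 ≤ n → len n < len (suc n)
  len-step n 1≤n = subst (len n <_) (sym (len-suc n)) (m<m+n (len n) (gap-positive n 1≤n))

  len-< : ∀ {j n} → 1 ≤ j → j < n → len j < len n
  len-< {j} 1≤j j<n = <-≤-trans (len-step j 1≤j) (len-≤ j<n)

  len-injective : ∀ {j k} → 1 ≤ j → 1 ≤ k → len j ≡ len k → j ≡ k
  len-injective {j} {k} 1≤j 1≤k e with <-cmp j k
  ... | tri< j<k _ _ = ⊥-elim (<⇒≢ (len-< 1≤j j<k) e)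
  ... | tri≈ _ j≡k _ = j≡k
  ... | tri> _ _ k<j = ⊥-elim (<⇒≢ (len-< 1≤k k<j) (sym e))

  n≤len-suc : ∀ n → n ≤ len (suc n)
  n≤len-suc zero    = z≤n
  n≤len-suc (suc n) = ≤-trans (s≤s (n≤len-suc n)) (len-step (suc n) z<s)

  at-π-stable : ∀ {i j k} → i ≤ j → k < len i → at (π ψ j) k ≡ at (π ψ i) k
  at-π-stable {i} {k = k} i≤j k< with π-prefix i≤j
  ... | x , e = trans (cong (λ v → at v k) e) (at-++ˡ (π ψ i) x k<)

  π-prefix-of-w : ∀ i → PrefixOf (π ψ i)
  π-prefix-of-w i k k< with i ≤? suc (suc k)
  ... | yes i≤ = at-π-stable i≤ k<
  ... | no i≰  = sym (at-π-stable (<⇒≤ (≰⇒> i≰)) (n≤len-suc (suc k)))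

  palindrome-len : ∀ i → Palindrome (len i)
  palindrome-len i = prefix-palindrome (π-prefix-of-w i) (π-palindrome i)

  w-letter : ∀ {n c} → 1 ≤ n → ψ n ≡ inj₂ c → w ψ (len n) ≡ just c
  w-letter {suc i} {c} 1≤n e = begin
    w ψ (len n)                   ≡⟨ π-prefix-of-w (suc n) (len n) (len-step n 1≤n) ⟩
    at (π ψ (suc n)) (len n)      ≡⟨ cong (λ v → at v (len n)) (π-letter i e) ⟩
    at (P ++ c ∷ P) (len n)       ≡⟨ cong (at (P ++ c ∷ P)) (sym (+-identityʳ (len n))) ⟩
    at (P ++ c ∷ P) (len n + 0)   ≡⟨ at-++ʳ P (c ∷ P) 0 ⟩
    just c                        ∎
    where
    n = suc i
    P = π ψ n

  w-jump : ∀ {n m} → ψ n ≡ inj₁ m → 1 ≤ m → m < n → w ψ (len n) ≡ w ψ (len m)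
  w-jump {suc i} {m} e 1≤m m<n = begin
    w ψ (len n)                             ≡⟨ π-prefix-of-w (suc n) (len n) (len-step n z<s) ⟩
    at (π ψ (suc n)) (len n)                ≡⟨ cong (λ v → at v (len n)) (π-jump i e m<n) ⟩
    at (P ++ drop (len m) P) (len n)        ≡⟨ cong (at (P ++ drop (len m) P)) (sym (+-identityʳ (len n))) ⟩
    at (P ++ drop (len m) P) (len n + 0)    ≡⟨ at-++ʳ P (drop (len m) P) 0 ⟩
    at (drop (len m) P) 0                   ≡⟨ at-drop (len m) P 0 ⟩
    at P (len m + 0)                        ≡⟨ cong (at P) (+-identityʳ (len m)) ⟩
    at P (len m)                            ≡⟨ sym (π-prefix-of-w n (len m) (len-< 1≤m m<n)) ⟩
    w ψ (len m)                             ∎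
    where
    n = suc i
    P = π ψ n

  palindromes⇒period-len : ∀ j k {d} → len j + d ≡ len k → Period (len k) d
  palindromes⇒period-len j k {d} e =
    subst (λ L → Period L d) e
      (palindromes⇒period (len j) d (subst Palindrome (sym e) (palindrome-len k)) (palindrome-len j))

  gap-period : ∀ i → Period (len (suc i)) (gap i)
  gap-period i = palindromes⇒period-len i (suc i) (sym (len-suc i))

  jump-period : ∀ {n m} → ψ n ≡ inj₁ m → m < n → Period (len n) (gap n)
  jump-period {n} {m} e m<n = palindromes⇒period-len m n (len-jump e m<n)

  gap-≤ : ∀ n → 1 ≤ n → gap n ≤ suc (len n)
  gap-≤ n 1≤n with move n 1≤n
  ... | letter c e       = ≤-reflexive (gap-letter 1≤n e)
  ... | jump m e 1≤m m<n = m≤n⇒m≤1+n (subst (gap n ≤_) (len-jump e m<n) (m≤n+m (gap n) (len m)))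

  MinimalGap : ℕ → Set a
  MinimalGap i = NoShorterPeriod (len (suc i)) (gap i)

  in-T-1 : InT ψ 1
  in-T-1 with move 1 z<s
  ... | letter c e           = z<s , inj₂ (c , e)
  ... | jump m e 1≤m (s≤s m≤0) = ⊥-elim (1+n≰n (≤-trans 1≤m m≤0))

  in-T? : ∀ n → 1 ≤ n → Dec (InT ψ n)
  in-T? n 1≤n with move n 1≤n
  ... | letter c e = yes (1≤n , inj₂ (c , e))
  ... | jump m e 1≤m _ with m ≤? n ∸ 2
  ...   | yes m≤ = yes (1≤n , inj₁ (m , e , 1≤m , m≤))
  ...   | no m≰  = no λ
    { (_ , inj₁ (m′ , e′ , _ , m′≤)) → m≰ (subst (_≤ n ∸ 2) (inj₁-injective (trans (sym e′) e)) m′≤)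
    ; (_ , inj₂ (c , e′))            → inj₁≢inj₂ (trans (sym e) e′)
    }

  not-in-T : ∀ i → ¬ InT ψ (suc i) → ψ (suc i) ≡ inj₁ i
  not-in-T i ∉T with move (suc i) z<s
  ... | letter c e = ⊥-elim (∉T (z<s , inj₂ (c , e)))
  ... | jump m e 1≤m (s≤s m≤i) with m ≤? i ∸ 1
  ...   | yes m≤ = ⊥-elim (∉T (z<s , inj₁ (m , e , 1≤m , m≤)))
  ...   | no m≰  = trans e (cong inj₁ (≤-antisym m≤i (i≤m i m≰)))
    where
    i≤m : ∀ i → ¬ m ≤ i ∸ 1 → i ≤ m
    i≤m zero    _  = z≤n
    i≤m (suc i) m≰ = ≰⇒> m≰

  in-T-jump : ∀ {n m} → InT ψ n → ψ n ≡ inj₁ m → suc (suc m) ≤ n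
  in-T-jump {n} (_ , inj₁ (m , e′ , 1≤m , m≤)) e with trans (sym e) e′
  ... | refl = lemma n m≤
    where
    lemma : ∀ n → m ≤ n ∸ 2 → suc (suc m) ≤ n
    lemma (suc (suc n)) m≤n = s≤s (s≤s m≤n)
    lemma zero          m≤0 = ⊥-elim (1+n≰n (≤-trans 1≤m m≤0))
    lemma (suc zero)    m≤0 = ⊥-elim (1+n≰n (≤-trans 1≤m m≤0))
  in-T-jump (_ , inj₂ (c , e′)) e = ⊥-elim (inj₁≢inj₂ (trans (sym e) e′))

  previous-in-T : ∀ k t → 1 ≤ k → k < t → (∀ r → k < r → r < t → ¬ InT ψ r) → InT ψ t →
                  ∃ λ s → Consecutive ψ s t
  previous-in-T k t 1≤k k<t none t∈T with in-T? k 1≤k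
  ... | yes k∈T = k , k∈T , t∈T , k<t , none
  previous-in-T (suc zero)    t _ _   _    _   | no 1∉T = ⊥-elim (1∉T in-T-1)
  previous-in-T (suc (suc k)) t _ k<t none t∈T | no k∉T =
    previous-in-T (suc k) t z<s (<-trans (n<1+n (suc k)) k<t) none′ t∈T
    where
    none′ : ∀ r → suc k < r → r < t → ¬ InT ψ r
    none′ r k<r r<t with m≤n⇒m<n∨m≡n k<r
    ... | inj₁ k+1<r = none r k+1<r r<t
    ... | inj₂ refl  = k∉T

  gap-repeat : ∀ {j} → ψ (suc j) ≡ inj₁ j → gap (suc j) ≡ gap j
  gap-repeat {j} e = +-cancelˡ-≡ (len j) (gap (suc j)) (gap j) (trans (len-jump e (n<1+n j)) (len-suc j))

  minimal-gap⇒no-divisor-period : ∀ {n L d} c → MinimalGap n → 0 < d → d < gap n → gap n ≡ suc c * d →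
                                  gap n ≤ L → L ≤ len (suc n) → ¬ Period L d
  minimal-gap⇒no-divisor-period {n} {L} {d} c minimal d>0 d<pn pn≡ pn≤L L≤ perd =
    minimal d d>0 d<pn
      (period-extend d c (subst (Period (len (suc n))) pn≡ (gap-period n)) perd (subst (_≤ L) pn≡ pn≤L) L≤)

  jump-gap-large : ∀ {s m} → (∀ {j} → j ≤ s → 1 ≤ j → MinimalGap j) →
                   ψ s ≡ inj₁ m → 1 ≤ m → suc (suc m) ≤ s → ¬ (gap s + gap s ≤ suc (len s))
  jump-gap-large {suc n} {m} minimal e 1≤m (s≤s m<n) r+r≤ =
    minimal-gap⇒no-divisor-period {s} c (minimal ≤-refl z<s) r′>0 r′<r r≡ r≤len (len-≤ (n≤1+n s))
      (gap-period n)
    where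
    s = suc n
    r = gap s
    r′ = gap n
    m<s = m≤n⇒m≤1+n m<n
    1≤n = ≤-trans 1≤m (<⇒≤ m<n)
    minₙ = minimal (n≤1+n n) 1≤n
    r′>0 = gap-positive n 1≤n
    perr : Period (len s) r
    perr = jump-period e m<s
    r≤len : r ≤ len s
    r≤len = subst (r ≤_) (len-jump e m<s) (m≤n+m r (len m))
    r′≢r : r′ ≢ r
    r′≢r r′≡r = <⇒≢ m<n (len-injective 1≤m 1≤n (+-cancelʳ-≡ r (len m) (len n)
                  (trans (len-jump e m<s) (trans (len-suc n) (cong (len n +_) r′≡r)))))
    r′<r : r′ < r
    r′<r = ≤∧≢⇒< (≮⇒≥ (λ r<r′ → minₙ r (gap-positive s z<s) r<r′ perr)) r′≢r
    r′∣r : r′ ∣ r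
    r′∣r = no-shorter⇒∣ r′>0 (gap-period n) minₙ perr (≤-pred (≤-trans (+-monoˡ-< r r′<r) r+r≤))
    c = proj₁ (∣-positive⇒multiple r′∣r (gap-positive s z<s))
    r≡ = proj₂ (∣-positive⇒multiple r′∣r (gap-positive s z<s))

  module Run (s K : ℕ) (cons : Consecutive ψ s (suc (s + K))) where

    t : ℕ
    t = suc (s + K)

    r : ℕ
    r = gap s

    s∈T : InT ψ s
    s∈T = proj₁ cons

    t∈T : InT ψ t
    t∈T = proj₁ (proj₂ cons)

    s<t : s < t
    s<t = proj₁ (proj₂ (proj₂ cons))

    1≤s : 1 ≤ s
    1≤s = proj₁ s∈T

    r-positive : 0 < r
    r-positive = gap-positive s 1≤s

    ψ-run : ∀ {k} → k < K → ψ (suc (s + k)) ≡ inj₁ (s + k)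
    ψ-run {k} k<K = not-in-T (s + k) (none-between (suc (s + k)) (s≤s (m≤m+n s k)) (s≤s (+-monoʳ-< s k<K)))
      where
      none-between = proj₂ (proj₂ (proj₂ cons))

    gap-run : ∀ {k} → k ≤ K → gap (s + k) ≡ r
    gap-run {zero}  _   = cong gap (+-identityʳ s)
    gap-run {suc k} k<K = trans (cong gap (+-suc s k)) (trans (gap-repeat (ψ-run k<K)) (gap-run (<⇒≤ k<K)))

    len-run : ∀ {k} → k ≤ suc K → len (s + k) ≡ len s + k * r
    len-run {zero}  _ = trans (cong len (+-identityʳ s)) (sym (+-identityʳ (len s)))
    len-run {suc k} (s≤s k≤K) = begin
      len (s + suc k)         ≡⟨ cong len (+-suc s k) ⟩
      len (suc (s + k))       ≡⟨ len-suc (s + k) ⟩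
      len (s + k) + gap (s + k) ≡⟨ cong₂ _+_ (len-run (m≤n⇒m≤1+n k≤K)) (gap-run k≤K) ⟩
      len s + k * r + r       ≡⟨ shift (len s) k r ⟩
      len s + suc k * r       ∎
      where
      shift : ∀ l k r → l + k * r + r ≡ l + suc k * r
      shift = solve-∀

    w-run : ∀ {k} → k ≤ K → w ψ (len (s + k)) ≡ w ψ (len s)
    w-run {zero}  _   = cong (λ j → w ψ (len j)) (+-identityʳ s)
    w-run {suc k} k<K = trans (cong (λ j → w ψ (len j)) (+-suc s k))
                              (trans (w-jump (ψ-run k<K) (≤-trans 1≤s (m≤m+n s k)) ≤-refl) (w-run (<⇒≤ k<K)))

    len-t : len t ≡ len s + suc K * r
    len-t = trans (cong len (sym (+-suc s K))) (len-run ≤-refl)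

    len-before-t : len (s + K) + r ≡ len t
    len-before-t = trans (cong (len (s + K) +_) (sym (gap-run ≤-refl))) (sym (len-suc (s + K)))

    r-period : Period (len t) r
    r-period = subst (Period (len t)) (gap-run ≤-refl) (gap-period (s + K))

  DivisorFreeGap : ℕ → Set a
  DivisorFreeGap i = ∀ q → 0 < q → q < gap i → q ∣ gap i → ¬ Period (len (suc i)) q

  module Crossing (reduced : Reduced ψ) (s K : ℕ) (cons : Consecutive ψ s (suc (s + K)))
                  (below : ∀ {j} → j < suc (s + K) → 1 ≤ j → MinimalGap j) where

    open Run s K cons

    ψt≢ψs : ψ t ≢ ψ s
    ψt≢ψs = proj₁ (reduced s t cons)

    r-minimal : NoShorterPeriod (len t) r
    r-minimal = subst (NoShorterPeriod (len t)) (gap-run ≤-refl) (below ≤-refl (≤-trans 1≤s (m≤m+n s K)))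

    r∣period : ∀ {q} → 0 < q → Period (len t) q → q + q ≤ suc (len t) → r ∣ q
    r∣period {q} q>0 per q+q≤ with m≤n⇒m<n∨m≡n (≮⇒≥ (λ q<r → r-minimal q q>0 q<r per))
    ... | inj₂ refl = ∣-refl
    ... | inj₁ r<q  = no-shorter⇒∣ r-positive r-period r-minimal per (≤-pred (≤-trans (+-monoˡ-< q r<q) q+q≤))

    s-gap-large : ∀ {m} → ψ s ≡ inj₁ m → 1 ≤ m → ¬ (r + r ≤ suc (len s))
    s-gap-large e 1≤m = jump-gap-large (λ j≤s → below (≤-<-trans j≤s s<t)) e 1≤m (in-T-jump s∈T e)

    letter-crossing : ∀ {c q} → ψ t ≡ inj₂ c →
                      0 < q → q < gap t → q ∣ gap t → ¬ Period (len (suc t)) q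
    letter-crossing {c} {q} e q>0 q<pt q∣pt per = from-s (move s 1≤s)
      where
      pt≡ : gap t ≡ suc (len t)
      pt≡ = gap-letter z<s e
      q+q≤ : q + q ≤ suc (len t)
      q+q≤ = subst (q + q ≤_) pt≡ (m∣n∧m<n⇒m+m≤n q∣pt q<pt)
      r∣q : r ∣ q
      r∣q = r∣period q>0 (period-≤ (len-≤ (n≤1+n t)) per) q+q≤
      from-s : Move s → ⊥
      from-s (letter b eₛ) = ψt≢ψs (trans e (trans (cong inj₂ (just-injective w≡)) (sym eₛ)))
        where
        c′ = proj₁ (∣-positive⇒multiple r∣q q>0)
        q≡ = proj₂ (∣-positive⇒multiple r∣q q>0)
        r-period-suc : Period (len (suc t)) r
        r-period-suc = period-extend r c′ (subst (Period (len (suc t))) q≡ per) r-period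
                         (subst (_≤ len t) q≡ (≤-pred (subst (q <_) pt≡ q<pt))) (len-≤ (n≤1+n t))
        w≡ : just c ≡ just b
        w≡ = begin
          just c                   ≡⟨ sym (w-letter z<s e) ⟩
          w ψ (len t)              ≡⟨ cong (w ψ) (sym len-before-t) ⟩
          w ψ (len (s + K) + r)    ≡⟨ sym (r-period-suc (len (s + K)) (subst (_< len (suc t)) (sym len-before-t)
                                                                              (len-step t z<s))) ⟩
          w ψ (len (s + K))        ≡⟨ w-run ≤-refl ⟩
          w ψ (len s)              ≡⟨ w-letter 1≤s eₛ ⟩
          just b                   ∎
      from-s (jump m eₛ 1≤m m<s) = s-gap-large eₛ 1≤m (m∣n∧m<n⇒m+m≤n r∣suc-len r<suc-len)
        where
        pt≡′ : gap t ≡ suc K * r + suc (len s)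
        pt≡′ = trans pt≡ (trans (cong suc len-t) (+-comm (suc (len s)) (suc K * r)))
        r∣suc-len : r ∣ suc (len s)
        r∣suc-len = ∣m+n∣m⇒∣n (subst (r ∣_) pt≡′ (∣-trans r∣q q∣pt)) (n∣m*n (suc K))
        r<suc-len : r < suc (len s)
        r<suc-len = s≤s (subst (r ≤_) (len-jump eₛ m<s) (m≤n+m r (len m)))

    jump-crossing : ∀ {m q} → ψ t ≡ inj₁ m → 1 ≤ m → m < s →
                    0 < q → q < gap t → q ∣ gap t → ¬ Period (len (suc t)) q
    jump-crossing {m} {q} e 1≤m m<s q>0 q<pt q∣pt per = from-s (move s 1≤s)
      where
      len-m+pt : len m + gap t ≡ len t
      len-m+pt = len-jump e (<-trans m<s s<t)
      q+q≤ : q + q ≤ len t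
      q+q≤ = ≤-trans (m∣n∧m<n⇒m+m≤n q∣pt q<pt) (subst (gap t ≤_) len-m+pt (m≤n+m (gap t) (len m)))
      r∣pt : r ∣ gap t
      r∣pt = ∣-trans (r∣period q>0 (period-≤ (len-≤ (n≤1+n t)) per) (m≤n⇒m≤1+n q+q≤)) q∣pt
      D = proj₁ (m≤n⇒∃[o]m+o≡n (len-≤ (<⇒≤ m<s)))
      len-m+D : len m + D ≡ len s
      len-m+D = proj₂ (m≤n⇒∃[o]m+o≡n (len-≤ (<⇒≤ m<s)))
      pt≡ : gap t ≡ suc K * r + D
      pt≡ = +-cancelˡ-≡ (len m) (gap t) (suc K * r + D) (begin
        len m + gap t               ≡⟨ len-m+pt ⟩
        len t                     ≡⟨ len-t ⟩
        len s + suc K * r         ≡⟨ cong (_+ suc K * r) (sym len-m+D) ⟩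
        len m + D + suc K * r     ≡⟨ regroup (len m) D (suc K * r) ⟩
        len m + (suc K * r + D)   ∎)
        where
        regroup : ∀ x y z → x + y + z ≡ x + (z + y)
        regroup = solve-∀
      r∣D : r ∣ D
      r∣D = ∣m+n∣m⇒∣n (subst (r ∣_) pt≡ r∣pt) (n∣m*n (suc K))
      D>0 : 0 < D
      D>0 = +-cancelˡ-< (len m) 0 D (subst₂ _<_ (sym (+-identityʳ (len m))) (sym len-m+D) (len-< 1≤m m<s))
      r≤D : r ≤ D
      r≤D = ∣⇒≤ {{>-nonZero D>0}} r∣D
      D≤len-s : D ≤ len s
      D≤len-s = subst (D ≤_) len-m+D (m≤n+m D (len m))
      from-s : Move s → ⊥
      from-s (letter b eₛ) = <-irrefl refl (≤-trans (subst (_≤ D) (gap-letter 1≤s eₛ) r≤D) D≤len-s)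
      from-s (jump m′ eₛ 1≤m′ m′<s) with m≤n⇒m<n∨m≡n r≤D
      ... | inj₁ r<D  = s-gap-large eₛ 1≤m′ (m≤n⇒m≤1+n (≤-trans (m∣n∧m<n⇒m+m≤n r∣D r<D) D≤len-s))
      ... | inj₂ r≡D  = ψt≢ψs (trans e (trans (cong inj₁ m≡m′) (sym eₛ)))
        where
        m≡m′ : m ≡ m′
        m≡m′ = len-injective 1≤m 1≤m′ (+-cancelʳ-≡ r (len m) (len m′)
                 (trans (cong (len m +_) r≡D) (trans len-m+D (sym (len-jump eₛ m′<s)))))

    crossing : DivisorFreeGap t
    crossing q with move t z<s | proj₂ (reduced s t cons)
    ... | letter c e     | _                     = letter-crossing e
    ... | jump m e 1≤m _ | inj₁ (c , e′)         = ⊥-elim (inj₁≢inj₂ (trans (sym e) e′))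
    ... | jump m e 1≤m _ | inj₂ (m′ , e′ , m′<s) with trans (sym e) e′
    ...   | refl = jump-crossing e 1≤m m′<s

  crossing-gap : Reduced ψ → ∀ {s t} → Consecutive ψ s t →
                 (∀ {j} → j < t → 1 ≤ j → MinimalGap j) → DivisorFreeGap t
  crossing-gap reduced {s} cons below with m≤n⇒∃[o]m+o≡n (proj₁ (proj₂ (proj₂ cons)))
  ... | K , refl = Crossing.crossing reduced s K cons below

  gap+gap≤ : ∀ i → 1 ≤ i → gap i + gap i ≤ suc (len (suc i))
  gap+gap≤ i 1≤i = subst (gap i + gap i ≤_) (cong suc (sym (len-suc i))) (+-monoˡ-≤ (gap i) (gap-≤ i 1≤i))

  reduced⇒minimal-gaps : Reduced ψ → ∀ i → 1 ≤ i → MinimalGap i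
  reduced⇒minimal-gaps reduced = <-rec _ minimal
    where
    divisor-free : ∀ i → (∀ {j} → j < i → 1 ≤ j → MinimalGap j) → 1 ≤ i → DivisorFreeGap i
    divisor-free (suc zero) _ _ q q>0 q<p _ _ = <⇒≱ q>0 (≤-pred (≤-trans q<p (gap-≤ 1 z<s)))
    divisor-free (suc (suc i)) below _ with in-T? (suc (suc i)) z<s
    ... | no ∉T = λ q q>0 q<p _ per →
      below {suc i} ≤-refl z<s q q>0 (subst (q <_) (gap-repeat (not-in-T (suc i) ∉T)) q<p)
            (period-≤ (len-≤ (n≤1+n (suc (suc i)))) per)
    ... | yes ∈T =
      crossing-gap reduced (proj₂ (previous-in-T (suc i) (suc (suc i)) z<s ≤-refl nothing-between ∈T)) below
      where
      nothing-between : ∀ r → suc i < r → r < suc (suc i) → ¬ InT ψ r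
      nothing-between r i+1<r r<i+2 _ = <⇒≱ r<i+2 i+1<r

    minimal : ∀ i → (∀ {j} → j < i → 1 ≤ j → MinimalGap j) → 1 ≤ i → MinimalGap i
    minimal i below 1≤i = no-shorter-of-divisors (gap-period i) (gap+gap≤ i 1≤i) (divisor-free i below 1≤i)

  module Converse (s K : ℕ) (cons : Consecutive ψ s (suc (s + K)))
                  (minimalₜ : MinimalGap (suc (s + K))) where

    open Run s K cons

    gap-not-multiple : ∀ {m} e → ψ t ≡ inj₁ m → m < t → ¬ (len m + suc (suc e) * r ≡ len t)
    gap-not-multiple {m} e ψt m<t eq =
      minimal-gap⇒no-divisor-period {t} (suc e) minimalₜ r-positive r<pt pt≡ pt≤ (len-≤ (n≤1+n t)) r-period
      where
      pt≡ : gap t ≡ suc (suc e) * r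
      pt≡ = +-cancelˡ-≡ (len m) _ _ (trans (len-jump ψt m<t) (sym eq))
      pt≤ : gap t ≤ len t
      pt≤ = subst (gap t ≤_) (len-jump ψt m<t) (m≤n+m (gap t) (len m))
      r<pt : r < gap t
      r<pt = subst (r <_) (sym pt≡) (m<m+n r (≤-trans r-positive (m≤m+n r (e * r))))

    distinct : ψ t ≢ ψ s
    distinct ψt≡ψs with move s 1≤s
    ... | jump m eₛ 1≤m m<s = gap-not-multiple K (trans ψt≡ψs eₛ) (<-trans m<s (s≤s (m≤m+n s K))) (begin
      len m + (r + suc K * r) ≡⟨ sym (+-assoc (len m) r (suc K * r)) ⟩
      len m + r + suc K * r   ≡⟨ cong (_+ suc K * r) (len-jump eₛ m<s) ⟩
      len s + suc K * r       ≡⟨ sym len-t ⟩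
      len t                   ∎)
    ... | letter b eₛ =
      minimal-gap⇒no-divisor-period {t} (suc K) minimalₜ r-positive r<pt pt≡
        (≤-reflexive (gap-letter z<s ψt)) (len-step t z<s) r-period-suc
      where
      ψt = trans ψt≡ψs eₛ
      r≡ : r ≡ suc (len s)
      r≡ = gap-letter 1≤s eₛ
      pt≡ : gap t ≡ suc (suc K) * r
      pt≡ = trans (gap-letter z<s ψt) (trans (cong suc len-t) (cong (_+ suc K * r) (sym r≡)))
      r<pt : r < gap t
      r<pt = subst₂ _<_ (sym r≡) (sym (gap-letter z<s ψt)) (s≤s (len-< 1≤s (s≤s (m≤m+n s K))))
      r-period-suc : Period (suc (len t)) r
      r-period-suc x x< with x + r <? len t
      ... | yes x+r< = r-period x x+r<
      ... | no x+r≮  = begin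
        w ψ x              ≡⟨ cong (w ψ) x≡ ⟩
        w ψ (len (s + K))  ≡⟨ w-run ≤-refl ⟩
        w ψ (len s)        ≡⟨ w-letter 1≤s eₛ ⟩
        just b             ≡⟨ sym (w-letter z<s ψt) ⟩
        w ψ (len t)        ≡⟨ cong (w ψ) (sym x+r≡) ⟩
        w ψ (x + r)        ∎
        where
        x+r≡ : x + r ≡ len t
        x+r≡ = ≤-antisym (≤-pred x<) (≮⇒≥ x+r≮)
        x≡ : x ≡ len (s + K)
        x≡ = +-cancelʳ-≡ r x (len (s + K)) (trans x+r≡ (sym len-before-t))

    returns-early : (∃ λ (c : A) → ψ t ≡ inj₂ c) ⊎ (∃ λ m → ψ t ≡ inj₁ m × m < s)
    returns-early with move t z<s
    ... | letter c e = inj₁ (c , e)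
    ... | jump m e 1≤m m<t with m <? s
    ...   | yes m<s = inj₂ (m , e , m<s)
    ...   | no m≮s with m≤n⇒∃[o]m+o≡n (≮⇒≥ m≮s)
    ...     | k , refl
      with m≤n⇒∃[o]m+o≡n (+-cancelˡ-≤ s (suc k) K (≤-pred (subst (_≤ t) (cong suc (sym (+-suc s k))) (in-T-jump t∈T e))))
    ...       | e′ , refl = ⊥-elim (gap-not-multiple e′ e m<t (begin
      len (s + k) + suc (suc e′) * r     ≡⟨ cong (_+ suc (suc e′) * r) (len-run k≤K+1) ⟩
      len s + k * r + suc (suc e′) * r   ≡⟨ regroup (len s) k e′ r ⟩
      len s + suc K * r                  ≡⟨ sym len-t ⟩
      len t                              ∎))
      where
      k≤K+1 : k ≤ suc K
      k≤K+1 = ≤-trans (m≤m+n k e′) (≤-trans (n≤1+n _) (n≤1+n _))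
      regroup : ∀ l k e r → l + k * r + suc (suc e) * r ≡ l + suc (suc (k + e)) * r
      regroup = solve-∀

  minimal-gaps⇒reduced : (∀ i → 1 ≤ i → MinimalGap i) → Reduced ψ
  minimal-gaps⇒reduced minimal s t cons with m≤n⇒∃[o]m+o≡n (proj₁ (proj₂ (proj₂ cons)))
  ... | K , refl = Converse.distinct s K cons minimalₜ , Converse.returns-early s K cons minimalₜ
    where
    minimalₜ = minimal (suc (s + K)) z<s

  PalindromicLengthsAreπ : Set a
  PalindromicLengthsAreπ = ∀ L → Palindrome L → ∃ λ j → 1 ≤ j × L ≡ len j

  bracket : ∀ L → ∃ λ i → 1 ≤ i × len i ≤ L × L < len (suc i)
  bracket zero = 1 , z<s , z≤n , len-step 1 z<s
  bracket (suc L) with bracket L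
  ... | i , 1≤i , lenᵢ≤L , L< with suc L <? len (suc i)
  ...   | yes L+1< = i , 1≤i , m≤n⇒m≤1+n lenᵢ≤L , L+1<
  ...   | no L+1≮  = suc i , z<s , ≮⇒≥ L+1≮ , ≤-<-trans L< (len-step (suc i) z<s)

  minimal-gaps⇒palindromic-lengths-are-π : (∀ i → 1 ≤ i → MinimalGap i) → PalindromicLengthsAreπ
  minimal-gaps⇒palindromic-lengths-are-π minimal L palL with bracket L
  ... | i , 1≤i , lenᵢ≤L , L< with m≤n⇒m<n∨m≡n lenᵢ≤L
  ...   | inj₂ lenᵢ≡L = i , 1≤i , sym lenᵢ≡L
  ...   | inj₁ lenᵢ<L = ⊥-elim (minimal i 1≤i q (m<n⇒0<n∸m L<) q<p per)
    where
    q = len (suc i) ∸ L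
    L+q : L + q ≡ len (suc i)
    L+q = m+[n∸m]≡n (<⇒≤ L<)
    per : Period (len (suc i)) q
    per = subst (λ L′ → Period L′ q) L+q
            (palindromes⇒period L q (subst Palindrome (sym L+q) (palindrome-len (suc i))) palL)
    q<p : q < gap i
    q<p = +-cancelˡ-< (len i) q (gap i) (subst (len i + q <_) (trans L+q (len-suc i)) (+-monoˡ-< q lenᵢ<L))

  palindromic-lengths-are-π⇒minimal-gaps : PalindromicLengthsAreπ → ∀ i → 1 ≤ i → MinimalGap i
  palindromic-lengths-are-π⇒minimal-gaps onlyπ i 1≤i q q>0 q<p per =
    strictly-between (onlyπ L (period⇒palindrome q L palqL perqL))
    where
    L = len (suc i) ∸ q
    q+L : q + L ≡ len (suc i)
    q+L = m+[n∸m]≡n (≤-trans (<⇒≤ q<p) (subst (gap i ≤_) (sym (len-suc i)) (m≤n+m (gap i) (len i))))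
    palqL = subst Palindrome (sym q+L) (palindrome-len (suc i))
    perqL = subst (λ L′ → Period L′ q) (sym q+L) per
    lenᵢ<L : len i < L
    lenᵢ<L = +-cancelʳ-< q (len i) L
               (subst (len i + q <_) (trans (sym (len-suc i)) (trans (sym q+L) (+-comm q L))) (+-monoʳ-< (len i) q<p))
    L<lenᵢ₊₁ : L < len (suc i)
    L<lenᵢ₊₁ = subst (L <_) q+L (m<n+m L q>0)
    strictly-between : (∃ λ j → 1 ≤ j × L ≡ len j) → ⊥
    strictly-between (j , _ , L≡) with j ≤? i
    ... | yes j≤i = <⇒≱ lenᵢ<L (subst (_≤ len i) (sym L≡) (len-≤ j≤i))
    ... | no j≰i  = <⇒≱ L<lenᵢ₊₁ (subst (len (suc i) ≤_) (sym L≡) (len-≤ (≰⇒> j≰i)))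

  π-palindromic-prefix : ∀ i → IsPalindrome (π ψ i) × IsPrefixOfW ψ (π ψ i)
  π-palindromic-prefix i = π-palindrome i , π-prefix-of-w i

  PalindromicPrefixesAreπ : Set a
  PalindromicPrefixesAreπ = ∀ u → IsPalindrome u × IsPrefixOfW ψ u → ∃ λ i → 1 ≤ i × u ≡ π ψ i

  palindromic-lengths⇒palindromic-prefixes : PalindromicLengthsAreπ → PalindromicPrefixesAreπ
  palindromic-lengths⇒palindromic-prefixes onlyπ u (pal , pre) with onlyπ (length u) (prefix-palindrome pre pal)
  ... | i , 1≤i , L≡ =
    i , 1≤i , ≡-by-at u (π ψ i) L≡ (λ k k< → trans (sym (pre k k<)) (π-prefix-of-w i k (subst (k <_) L≡ k<)))

  palindromic-prefixes⇒palindromic-lengths : PalindromicPrefixesAreπ → PalindromicLengthsAreπ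
  palindromic-prefixes⇒palindromic-lengths onlyπ L palL = j , 1≤j , trans (sym length-u) (cong length u≡)
    where
    u = take L (π ψ (suc L))
    length-u : length u ≡ L
    length-u = trans (length-take L (π ψ (suc L))) (m≤n⇒m⊓n≡m (n≤len-suc L))
    pre : PrefixOf u
    pre k k< = trans (π-prefix-of-w (suc L) k (≤-trans k<L (n≤len-suc L))) (sym (at-take L (π ψ (suc L)) k<L))
      where
      k<L = subst (k <_) length-u k<
    found = onlyπ u (palindrome-prefix pre (subst Palindrome (sym length-u) palL) , pre)
    j = proj₁ found
    1≤j = proj₁ (proj₂ found)
    u≡ = proj₂ (proj₂ found)

theorem4p12 : {ℓ : Level} (A : Set ℓ) (ψ : ℕ → ℕ ⊎ A) →
    (∀ n → 1 ≤ n → (∃ λ (a : A) → ψ n ≡ inj₂ a)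
                   ⊎ (∃ λ m → ψ n ≡ inj₁ m × 1 ≤ m × m ≤ n ∸ 1)) →
    Reduced ψ ⇔ (∀ (u : List A) →
      (IsPalindrome u × IsPrefixOfW ψ u) ⇔ (∃ λ i → 1 ≤ i × u ≡ π ψ i))
theorem4p12 A ψ admissible = mk⇔
  (λ reduced u → mk⇔
     (palindromic-lengths⇒palindromic-prefixes (minimal-gaps⇒palindromic-lengths-are-π (reduced⇒minimal-gaps reduced)) u)
     (λ { (i , _ , refl) → π-palindromic-prefix i }))
  (λ onlyπ → minimal-gaps⇒reduced (palindromic-lengths-are-π⇒minimal-gaps
     (palindromic-prefixes⇒palindromic-lengths (λ u → Equivalence.to (onlyπ u)))))
  where
  open Construction ψ admissible
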